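{- Let $N\ge k+1$. There exist a family of request sequences $\{I_n\}_{n\ge1}$ respecting the access graph $P_N$ and a constant $b$ such that $\lim_{n\to\infty}\mathrm{LRU}(I_n)=\infty$ and, for all $n$, $$\mathrm{FIFO}^{P_N}_W(I_n)\ge \frac{k+1}{2}\,\mathrm{LRU}^{P_N}_W(I_n)+b.$$
   Context: Paging: a cache of size $k\ge1$, initially empty; on a request to a page not in cache (a fault) the page is brought in, evicting a page if the cache is full; $\mathrm{A}(I)$ is the number of faults of algorithm $\mathrm{A}$ on $I$. LRU evicts the least recently requested page in cache; FIFO evicts the page that has been in cache the longest. An access graph is an undirected graph whose vertices are the pages; a sequence respects it if any two consecutive requests are to the same page or to adjacent vertices. $P_N$ is the path graph on $N$ vertices. For an algorithm $\mathrm{A}$ and access graph $G$, $\mathrm{A}^G_W(I)=\max_\sigma \mathrm{A}(\sigma(I))$ over all permutations $\sigma$ of the requests of $I$ such that $\sigma(I)$ respects $G$. -}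

module Defs where

open import Data.Nat using (ℕ; zero; suc; _+_; _≤_)
open import Data.Fin using (Fin; toℕ; _≟_)
open import Data.List using (List; []; _∷_; take; filter)
open import Data.Product using (_×_; ∃-syntax)
open import Data.Sum using (_⊎_)
open import Data.Unit using (⊤)
import Data.List.Membership.DecPropositional
open import Relation.Nullary using (yes; no)
open import Relation.Nullary.Decidable using (¬?)
open import Relation.Binary.PropositionalEquality using (_≡_)
open import Data.List.Relation.Binary.Permutation.Propositional using (_↭_)

-- Pages are the vertices 0,…,N-1 of the path graph P_N, i.e. elements of Fin N.
-- A cache state is a list of distinct pages (length ≤ k).

data Outcome (N : ℕ) : Set where
  hit   : List (Fin N) → Outcome N
  fault : List (Fin N) → Outcome N

-- LRU: cache ordered by recency of request, most recent first.  Fault: put page at the front and,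
-- if the cache was full (k pages), evict the last (= least recently requested).
lruStep : ∀ {N} → ℕ → List (Fin N) → Fin N → Outcome N
lruStep k c p with Data.List.Membership.DecPropositional._∈?_ _≟_ p c
... | yes _ = hit (p ∷ filter (λ q → ¬? (q ≟ p)) c)
... | no _  = fault (take k (p ∷ c))

-- FIFO: cache ordered by time of insertion, most recently inserted first.  Fault: insert at the front and, if the cache was
-- full, evict the last (= the page in cache the longest).
fifoStep : ∀ {N} → ℕ → List (Fin N) → Fin N → Outcome N
fifoStep k c p with Data.List.Membership.DecPropositional._∈?_ _≟_ p c
... | yes _ = hit c
... | no _  = fault (take k (p ∷ c))

runFaults : ∀ {N} → (List (Fin N) → Fin N → Outcome N) → List (Fin N) → List (Fin N) → ℕ
runFaults step c [] = 0
runFaults step c (p ∷ ps) with step c p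
... | hit c'   = runFaults step c' ps
... | fault c' = suc (runFaults step c' ps)

LRU : ∀ {N} → ℕ → List (Fin N) → ℕ
LRU k I = runFaults (lruStep k) [] I

FIFO : ∀ {N} → ℕ → List (Fin N) → ℕ
FIFO k I = runFaults (fifoStep k) [] I

PathAdj : ∀ {N} → Fin N → Fin N → Set
PathAdj i j = (suc (toℕ i) ≡ toℕ j) ⊎ (suc (toℕ j) ≡ toℕ i)

RespectsPath : ∀ {N} → List (Fin N) → Set
RespectsPath [] = ⊤
RespectsPath (p ∷ []) = ⊤
RespectsPath (p ∷ q ∷ qs) = ((p ≡ q) ⊎ PathAdj p q) × RespectsPath (q ∷ qs)

-- m is the worst-case value A^{P_N}_W(I) = max { A(σ(I)) : σ(I) a permutation
-- of the requests of I respecting P_N }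
IsWorstPath : ∀ {N} → (List (Fin N) → ℕ) → List (Fin N) → ℕ → Set
IsWorstPath {N} A I m =
  (∃[ J ] (J ↭ I × RespectsPath J × A J ≡ m)) ×
  (∀ (J : List (Fin N)) → J ↭ I → RespectsPath J → A J ≤ m)

module Submission where

-- The witness family is the zigzag
-- walk on the vertices 0, …, k:  I n = (0, 1, …, k) followed by n rounds (k-1, …, 1, 0, …, k).
-- FIFO: its cache is take k of the pages it faulted on; as k + 1 distinct pages are requested
--   cyclically in each up sweep, every such request faults and the descents hit:
--   FIFO_W(I n) ≥ FIFO(I n) = (n + 1)(k + 1).
-- LRU: its cache is the k most recently requested distinct pages.  An interior page requested
--   again right after a neighbour is still cached, since the walk stayed on one side of it,
--   where fewer than k vertices lie.  So LRU faults only on first requests (≤ k + 1) and on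
--   requests to the ends 0 and k, 2(n + 1) in any reordering: LRU_W(I n) ≤ (k + 1) + 2(n + 1).
--   Each round holds k + 1 distinct pages, so LRU(I n) ≥ n → ∞.
-- Hence (k + 1)·LRU_W ≤ 2·FIFO_W + 2(k + 1)², i.e. b = -(k + 1)².

open import Defs
open import Data.Nat using (ℕ; zero; suc; _+_; _*_; _∸_; _≤_; _<_; z≤n; s≤s)
import Data.Nat as ℕ
open import Data.Nat.Properties
  using ( ≤-refl; ≤-reflexive; ≤-trans; ≤-<-trans; ≤-pred; <-irrefl; <⇒≤; <⇒≱; ≤∧≢⇒<
        ; n≤1+n; m≤n⇒m≤1+n; n≢0⇒n>0; suc-injective; m≤m+n
        ; +-suc; +-comm; +-identityʳ; +-mono-≤; +-monoˡ-≤; +-monoʳ-≤; *-monoʳ-≤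
        ; ∸-monoˡ-<; ∸-monoʳ-<; m+[n∸m]≡n; m⊓n≤m; m⊓n≤n; m≤n⇒m⊓n≡m; module ≤-Reasoning )
open import Data.Nat.Solver using (module +-*-Solver)
open +-*-Solver using (solve; _:*_; _:+_; con; _:=_)
open import Data.Fin using (Fin; toℕ; fromℕ<; _≟_)
open import Data.Fin.Properties using (toℕ-injective; toℕ-fromℕ<)
open import Data.List
  using ( List; []; _∷_; _++_; _ʳ++_; [_]; take; filter; map; length; concat; replicate
        ; applyUpTo; applyDownFrom )
open import Data.List.Properties
  using ( length-map; length-take; length-++; length-applyUpTo; take-take; applyUpTo-∷ʳ
        ; ++-assoc; ++-ʳ++
        ; filter-notAll; filter-all; filter-none; filter-accept; filter-reject; filter-++ )
open import Data.List.Membership.Propositional using (_∈_; _∉_; find; lose)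
open import Data.List.Membership.Propositional.Properties
  using (∈-filter⁺; ∈-filter⁻; ∈-applyUpTo⁺; ∈-map⁻; ∈-++⁺ˡ; ∈-++⁺ʳ)
import Data.List.Membership.DecPropositional as DecMembership
open import Data.List.Relation.Unary.Any as Any using (Any; here; there)
import Data.List.Relation.Unary.Any.Properties as Any
open import Data.List.Relation.Unary.All as All using (All; []; _∷_; all?)
import Data.List.Relation.Unary.All.Properties as All
open import Data.List.Relation.Unary.AllPairs using ([]; _∷_)
open import Data.List.Relation.Unary.Unique.Propositional using (Unique)
import Data.List.Relation.Unary.Unique.Propositional.Properties as Unique
open import Data.List.Relation.Binary.Subset.Propositional using (_⊆_)
open import Data.List.Relation.Binary.Permutation.Propositional using (_↭_; ↭-refl; ↭-sym)
open import Data.List.Relation.Binary.Permutation.Propositional.Properties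
  using (All-resp-↭; filter-↭; ↭-length)
open import Data.Product using (_×_; _,_; proj₁; proj₂; Σ-syntax; ∃-syntax)
open import Data.Sum using (_⊎_; inj₁; inj₂)
open import Data.Unit using (⊤; tt)
open import Data.Integer using (ℤ; +_; -_; +≤+) renaming (_+_ to _+ℤ_; _*_ to _*ℤ_; _≤_ to _≤ℤ_)
import Data.Integer.Properties as ℤ
open import Function using (_∘_)
open import Relation.Nullary using (¬_; yes; no; Dec; contradiction)
open import Relation.Nullary.Decidable using (¬?; _⊎-dec_)
open import Relation.Binary.Definitions using (DecidableEquality)
open import Relation.Binary.PropositionalEquality
  using (_≡_; _≢_; refl; sym; trans; cong; cong₂; subst; subst₂; module ≡-Reasoning)

∈-take⁻ : ∀ {A : Set} {x : A} n {xs} → x ∈ take n xs → x ∈ xs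
∈-take⁻ (suc n) {_ ∷ _} (here e)  = here e
∈-take⁻ (suc n) {_ ∷ _} (there m) = there (∈-take⁻ n m)

take-take-suc : ∀ {A : Set} n (xs : List A) → take n (take (suc n) xs) ≡ take n xs
take-take-suc n xs =
  trans (take-take n (suc n) xs) (cong (λ m → take m xs) (m≤n⇒m⊓n≡m (n≤1+n n)))

take-ʳ++ : ∀ {A : Set} (as : List A) m X → take (length as + m) (as ʳ++ X) ≡ as ʳ++ take m X
take-ʳ++ []       m X = refl
take-ʳ++ (a ∷ as) m X = trans (cong (λ n → take n (as ʳ++ (a ∷ X))) (sym (+-suc (length as) m)))
                               (take-ʳ++ as (suc m) (a ∷ X))

∈-ʳ++⁻ : ∀ {A : Set} {x : A} as {bs} → x ∈ as ʳ++ bs → x ∈ as ⊎ x ∈ bs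
∈-ʳ++⁻ as {bs} x∈ with Any.reverseAcc⁻ bs as x∈
... | inj₁ x∈bs = inj₂ x∈bs
... | inj₂ x∈as = inj₁ x∈as

unique-middle : ∀ {A : Set} {q : A} ys {zs} → Unique (ys ++ q ∷ zs) → q ∉ ys ++ zs
unique-middle []       (q∉zs ∷ _)   q∈zs        = All.lookup q∉zs q∈zs refl
unique-middle (y ∷ ys) (y∉ ∷ _)     (here refl) = All.lookup y∉ (∈-++⁺ʳ ys (here refl)) refl
unique-middle (y ∷ ys) (_ ∷ uniq)   (there q∈)  = unique-middle ys uniq q∈

module _ {A : Set} (_≟_ : DecidableEquality A) where
  open DecMembership _≟_ using (_∈?_)

  unique⊆⇒length≤ : ∀ {xs ys : List A} → Unique xs → xs ⊆ ys → length xs ≤ length ys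
  unique⊆⇒length≤ {[]} _ _ = z≤n
  unique⊆⇒length≤ {x ∷ xs} {ys} (x∉xs ∷ uniq) xs⊆ys =
    ≤-trans (s≤s (unique⊆⇒length≤ uniq xs⊆ys-x)) (filter-notAll (λ y → ¬? (x ≟ y)) ys x∈ys)
    where
    x∈ys : Any (λ y → ¬ ¬ (x ≡ y)) ys
    x∈ys = Any.map (λ x≡y x≢y → x≢y x≡y) (xs⊆ys (here refl))
    xs⊆ys-x : xs ⊆ filter (λ y → ¬? (x ≟ y)) ys
    xs⊆ys-x y∈xs = ∈-filter⁺ (λ y → ¬? (x ≟ y)) (xs⊆ys (there y∈xs)) (All.lookup x∉xs y∈xs)

  longer⇒∉ : ∀ {xs : List A} (c : List A) → Unique xs → length c < length xs → Any (_∉ c) xs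
  longer⇒∉ {xs} c uniq c<xs with all? (_∈? c) xs
  ... | yes xs⊆c = contradiction (unique⊆⇒length≤ uniq (All.lookup xs⊆c)) (<⇒≱ c<xs)
  ... | no ¬xs⊆c = All.¬All⇒Any¬ (_∈? c) xs ¬xs⊆c

unique-range : ∀ {N} {xs : List (Fin N)} lo hi → Unique xs →
               All (λ x → lo ≤ toℕ x × toℕ x < hi) xs → length xs ≤ hi ∸ lo
unique-range {xs = xs} lo hi uniq inRange =
  subst₂ _≤_ (length-map toℕ xs) (length-applyUpTo (lo ℕ.+_) (hi ∸ lo))
    (unique⊆⇒length≤ ℕ._≟_ (Unique.map⁺ toℕ-injective uniq) covered)
  where
  covered : map toℕ xs ⊆ applyUpTo (lo ℕ.+_) (hi ∸ lo)
  covered v∈ with ∈-map⁻ toℕ v∈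
  ... | x , x∈xs , refl =
    let (lo≤x , x<hi) = All.lookup inRange x∈xs in
    subst (_∈ applyUpTo (lo ℕ.+_) (hi ∸ lo)) (m+[n∸m]≡n lo≤x)
      (∈-applyUpTo⁺ (lo ℕ.+_) (∸-monoˡ-< x<hi lo≤x))

Step : ∀ {N} → Fin N → Fin N → Set
Step x y = (x ≡ y) ⊎ PathAdj x y

step-sym : ∀ {N} {x y : Fin N} → Step x y → Step y x
step-sym (inj₁ refl)      = inj₁ refl
step-sym (inj₂ (inj₁ e))  = inj₂ (inj₂ e)
step-sym (inj₂ (inj₂ e))  = inj₂ (inj₁ e)

step-≤ : ∀ {N} {x y : Fin N} → Step x y → toℕ y ≤ suc (toℕ x)
step-≤ (inj₁ refl)     = n≤1+n _
step-≤ (inj₂ (inj₁ e)) = subst (_≤ suc _) e ≤-refl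
step-≤ (inj₂ (inj₂ e)) = m≤n⇒m≤1+n (subst (_ ≤_) e (n≤1+n _))

respects-tail : ∀ {N} {x : Fin N} {xs} → RespectsPath (x ∷ xs) → RespectsPath xs
respects-tail {xs = []}     _          = tt
respects-tail {xs = _ ∷ _} (_ , rest) = rest

respects-ʳ++ : ∀ {N} (xs : List (Fin N)) {ys} → RespectsPath (xs ʳ++ ys) → RespectsPath ys
respects-ʳ++ []       r = r
respects-ʳ++ (x ∷ xs) r = respects-tail (respects-ʳ++ xs r)

reverse-respects : ∀ {N} {x : Fin N} xs {ys} →
  RespectsPath (x ∷ xs) → RespectsPath (x ∷ ys) → RespectsPath (xs ʳ++ (x ∷ ys))
reverse-respects []       _             rys = rys
reverse-respects (y ∷ xs) (xy , rxs) rys = reverse-respects xs rxs (step-sym xy , rys)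

respects-reverse : ∀ {N} (xs : List (Fin N)) → RespectsPath xs → RespectsPath (xs ʳ++ [])
respects-reverse []       _ = tt
respects-reverse (x ∷ xs) r = reverse-respects xs r tt

-- Walk x y xs: the requests xs may follow a request to x, and the last request is to y.
data Walk {N} : Fin N → Fin N → List (Fin N) → Set where
  stay : ∀ {x} → Walk x x []
  move : ∀ {x y z ys} → Step x y → Walk y z ys → Walk x z (y ∷ ys)

walk-++ : ∀ {N} {x y z : Fin N} {xs ys} → Walk x y xs → Walk y z ys → Walk x z (xs ++ ys)
walk-++ stay        w = w
walk-++ (move s w₁) w = move s (walk-++ w₁ w)

walk-respects : ∀ {N} {x y : Fin N} {xs} → Walk x y xs → RespectsPath (x ∷ xs)
walk-respects stay                    = tt
walk-respects (move s stay)           = s , tt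
walk-respects (move s w@(move _ _))   = s , walk-respects w

ascending : ∀ {N} (f : ℕ → Fin N) n → (∀ {i} → i < n → Step (f i) (f (suc i))) →
            Walk (f 0) (f n) (applyUpTo (f ∘ suc) n)
ascending f zero    _     = stay
ascending f (suc n) steps = move (steps (s≤s z≤n)) (ascending (f ∘ suc) n (steps ∘ s≤s))

descending : ∀ {N} (f : ℕ → Fin N) n → (∀ {i} → i < n → Step (f (suc i)) (f i)) →
             Walk (f n) (f 0) (applyDownFrom f n)
descending f zero    _     = stay
descending f (suc n) steps = move (steps ≤-refl) (descending f n (steps ∘ m≤n⇒m≤1+n))

_∈?_ : ∀ {N} (p : Fin N) (c : List (Fin N)) → Dec (p ∈ c)
_∈?_ = DecMembership._∈?_ _≟_

runFaults-hit : ∀ {N} {step : List (Fin N) → Fin N → Outcome N} {c c' p} ps →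
  step c p ≡ hit c' → runFaults step c (p ∷ ps) ≡ runFaults step c' ps
runFaults-hit _ e rewrite e = refl

runFaults-fault : ∀ {N} {step : List (Fin N) → Fin N → Outcome N} {c c' p} ps →
  step c p ≡ fault c' → runFaults step c (p ∷ ps) ≡ suc (runFaults step c' ps)
runFaults-fault _ e rewrite e = refl

evict : ∀ {N} → Fin N → List (Fin N) → List (Fin N)
evict q = filter (λ x → ¬? (x ≟ q))

lruStep-hit : ∀ {N} k {c : List (Fin N)} {q} → q ∈ c → lruStep k c q ≡ hit (q ∷ evict q c)
lruStep-hit k {c} {q} q∈c with q ∈? c
... | yes _   = refl
... | no q∉c  = contradiction q∈c q∉c

lruStep-fault : ∀ {N} k {c : List (Fin N)} {q} → q ∉ c → lruStep k c q ≡ fault (take k (q ∷ c))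
lruStep-fault k {c} {q} q∉c with q ∈? c
... | yes q∈c = contradiction q∈c q∉c
... | no _    = refl

fifoStep-hit : ∀ {N} k {c : List (Fin N)} {q} → q ∈ c → fifoStep k c q ≡ hit c
fifoStep-hit k {c} {q} q∈c with q ∈? c
... | yes _   = refl
... | no q∉c  = contradiction q∈c q∉c

fifoStep-fault : ∀ {N} k {c : List (Fin N)} {q} → q ∉ c → fifoStep k c q ≡ fault (take k (q ∷ c))
fifoStep-fault k {c} {q} q∉c with q ∈? c
... | yes q∈c = contradiction q∈c q∉c
... | no _    = refl

evict-∉ : ∀ {N} {q : Fin N} {c} → q ∉ c → evict q c ≡ c
evict-∉ q∉c = filter-all (λ x → ¬? (x ≟ _)) (All.tabulate (λ x∈c x≡q → q∉c (subst (_∈ _) x≡q x∈c)))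

∈-evict⁻ : ∀ {N} {q x : Fin N} {c} → x ∈ evict q c → x ∈ c
∈-evict⁻ x∈ = proj₁ (∈-filter⁻ (λ x → ¬? (x ≟ _)) x∈)

evict-take-∉ : ∀ {N} {q : Fin N} n {R} → q ∉ take (suc n) R → take n (evict q R) ≡ take n R
evict-take-∉ zero    _ = refl
evict-take-∉ (suc n) {[]} _ = refl
evict-take-∉ {q = q} (suc n) {y ∷ R} q∉ =
  trans (cong (take (suc n)) (filter-accept (λ x → ¬? (x ≟ q)) (λ y≡q → q∉ (here (sym y≡q)))))
        (cong (y ∷_) (evict-take-∉ n (λ q∈ → q∉ (there q∈))))

evict-take-∈ : ∀ {N} {q : Fin N} n {R} → Unique R → q ∈ take (suc n) R →
               evict q (take (suc n) R) ≡ take n (evict q R)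
evict-take-∈ {q = q} n {q ∷ R} (q∉R ∷ _) (here refl) = begin
  evict q (q ∷ take n R)  ≡⟨ evict-head ⟩
  evict q (take n R)      ≡⟨ evict-∉ (λ q∈ → All.lookup q∉R (∈-take⁻ n q∈) refl) ⟩
  take n R                ≡⟨ cong (take n) (evict-∉ (λ q∈ → All.lookup q∉R q∈ refl)) ⟨
  take n (evict q R)      ≡⟨ cong (take n) evict-head ⟨
  take n (evict q (q ∷ R)) ∎
  where
  open ≡-Reasoning
  evict-head : ∀ {xs} → evict q (q ∷ xs) ≡ evict q xs
  evict-head = filter-reject (λ x → ¬? (x ≟ q)) (λ q≢q → q≢q refl)
evict-take-∈ {q = q} (suc n) {y ∷ R} (y∉R ∷ uniq) (there q∈) = begin
  evict q (y ∷ take (suc n) R)   ≡⟨ evict-other ⟩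
  y ∷ evict q (take (suc n) R)   ≡⟨ cong (y ∷_) (evict-take-∈ n uniq q∈) ⟩
  y ∷ take n (evict q R)         ≡⟨ cong (take (suc n)) evict-other ⟨
  take (suc n) (evict q (y ∷ R)) ∎
  where
  open ≡-Reasoning
  evict-other : ∀ {xs} → evict q (y ∷ xs) ≡ y ∷ evict q xs
  evict-other = filter-accept (λ x → ¬? (x ≟ q)) (λ y≡q → All.lookup y∉R (∈-take⁻ (suc n) q∈) y≡q)

-- recency h: the distinct pages of a history h (latest request first), each listed once,
-- ordered by the time of their latest request (most recent first).
recency : ∀ {N} → List (Fin N) → List (Fin N)
recency []      = []
recency (q ∷ h) = q ∷ evict q (recency h)

recency-unique : ∀ {N} (h : List (Fin N)) → Unique (recency h)
recency-unique []      = []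
recency-unique (q ∷ h) =
  All.tabulate (λ x∈ q≡x → proj₂ (∈-filter⁻ (λ x → ¬? (x ≟ q)) {xs = recency h} x∈) (sym q≡x))
  ∷ Unique.filter⁺ (λ x → ¬? (x ≟ q)) (recency-unique h)

∈-recency⁺ : ∀ {N} {x : Fin N} {h} → x ∈ h → x ∈ recency h
∈-recency⁺ {h = q ∷ h} (here refl) = here refl
∈-recency⁺ {x = x} {h = q ∷ h} (there x∈h) with x ≟ q
... | yes refl = here refl
... | no x≢q   = there (∈-filter⁺ (λ y → ¬? (y ≟ q)) (∈-recency⁺ x∈h) x≢q)

-- LRU with a cache of k = suc k' pages: after serving a history h from the empty cache,
-- the cache is the k most recently requested distinct pages.
module LRUCache (k' : ℕ) {N : ℕ} where

  k : ℕ
  k = suc k'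

  lruCache : List (Fin N) → List (Fin N)
  lruCache h = take k (recency h)

  lruFrom : List (Fin N) → List (Fin N) → ℕ
  lruFrom h J = runFaults (lruStep k) (lruCache h) J

  lruCache-hit : ∀ {h q} → q ∈ lruCache h → lruStep k (lruCache h) q ≡ hit (lruCache (q ∷ h))
  lruCache-hit {h} {q} q∈ =
    trans (lruStep-hit k q∈) (cong (λ c → hit (q ∷ c)) (evict-take-∈ k' (recency-unique h) q∈))

  lruCache-fault : ∀ {h q} → q ∉ lruCache h → lruStep k (lruCache h) q ≡ fault (lruCache (q ∷ h))
  lruCache-fault {h} {q} q∉ = trans (lruStep-fault k q∉)
    (cong (λ c → fault (q ∷ c)) (trans (take-take-suc k' (recency h)) (sym (evict-take-∉ k' q∉))))

  lru-serve : ∀ h q J →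
    (q ∈ lruCache h × lruFrom h (q ∷ J) ≡ lruFrom (q ∷ h) J) ⊎
    (q ∉ lruCache h × lruFrom h (q ∷ J) ≡ suc (lruFrom (q ∷ h) J))
  lru-serve h q J = serve (q ∈? lruCache h)
    where
    serve : Dec (q ∈ lruCache h) →
      (q ∈ lruCache h × lruFrom h (q ∷ J) ≡ lruFrom (q ∷ h) J) ⊎
      (q ∉ lruCache h × lruFrom h (q ∷ J) ≡ suc (lruFrom (q ∷ h) J))
    serve (yes q∈) = inj₁ (q∈ , runFaults-hit J (lruCache-hit q∈))
    serve (no q∉)  = inj₂ (q∉ , runFaults-fault J (lruCache-fault q∉))

  lruCache-hit-⊆ : ∀ {h q x} → q ∈ lruCache h → x ∈ lruCache (q ∷ h) → x ∈ lruCache h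
  lruCache-hit-⊆ q∈ (here refl) = q∈
  lruCache-hit-⊆ {h} q∈ (there x∈) =
    ∈-evict⁻ {c = lruCache h} (subst (_ ∈_) (sym (evict-take-∈ k' (recency-unique h) q∈)) x∈)

-- sinceLast q L: the entries of L before the first occurrence of q.  For a history L this
-- is what was requested since the last request to q.
sinceLast : ∀ {N} → Fin N → List (Fin N) → List (Fin N)
sinceLast q []      = []
sinceLast q (y ∷ L) with y ≟ q
... | yes _ = []
... | no _  = y ∷ sinceLast q L

sinceLast-⊆ : ∀ {N} {q x : Fin N} L → x ∈ sinceLast q L → x ∈ L
sinceLast-⊆ {q = q} (y ∷ L) x∈ with y ≟ q
sinceLast-⊆ (y ∷ L) (here refl) | no _ = here refl
sinceLast-⊆ (y ∷ L) (there x∈)  | no _ = there (sinceLast-⊆ L x∈)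

sinceLast-unique : ∀ {N} {q : Fin N} {L} → Unique L → Unique (sinceLast q L)
sinceLast-unique {L = []} _ = []
sinceLast-unique {q = q} {y ∷ L} (y∉L ∷ uniq) with y ≟ q
... | yes _ = []
... | no _  = All.tabulate (λ x∈ → All.lookup y∉L (sinceLast-⊆ L x∈)) ∷ sinceLast-unique uniq

sinceLast-length : ∀ {N} {q : Fin N} n L → q ∈ L → q ∉ take n L → n ≤ length (sinceLast q L)
sinceLast-length zero    L       _  _  = z≤n
sinceLast-length {q = q} (suc n) (y ∷ L) q∈ q∉ with y ≟ q
... | yes y≡q = contradiction (here (sym y≡q)) q∉
sinceLast-length (suc n) (y ∷ L) (here refl) q∉ | no y≢q = contradiction refl y≢q
sinceLast-length (suc n) (y ∷ L) (there q∈) q∉ | no _ =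
  s≤s (sinceLast-length n L q∈ (λ q∈′ → q∉ (there q∈′)))

sinceLast-evict : ∀ {N} {q y x : Fin N} L → y ≢ q → x ∈ sinceLast q (evict y L) → x ∈ sinceLast q L
sinceLast-evict {y = y} (z ∷ L) y≢q x∈ with z ≟ y
sinceLast-evict {q = q} (z ∷ L) y≢q x∈ | yes refl with z ≟ q
... | yes z≡q = contradiction z≡q y≢q
... | no _    = there (sinceLast-evict L y≢q x∈)
sinceLast-evict {q = q} (z ∷ L) y≢q x∈ | no _ with z ≟ q
sinceLast-evict (z ∷ L) y≢q (here refl) | no _ | no _ = here refl
sinceLast-evict (z ∷ L) y≢q (there x∈)  | no _ | no _ = there (sinceLast-evict L y≢q x∈)

sinceLast-recency : ∀ {N} {q x : Fin N} h → x ∈ sinceLast q (recency h) → x ∈ sinceLast q h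
sinceLast-recency {q = q} (y ∷ h) x∈ with y ≟ q
sinceLast-recency (y ∷ h) (here refl) | no _   = here refl
sinceLast-recency (y ∷ h) (there x∈)  | no y≢q =
  there (sinceLast-recency h (sinceLast-evict (recency h) y≢q x∈))

stays-below : ∀ {N} {q y : Fin N} h → RespectsPath (y ∷ h) → toℕ y ≤ toℕ q →
              All (λ x → toℕ x < toℕ q) (sinceLast q (y ∷ h))
stays-below {q = q} {y} h walk y≤q with y ≟ q
... | yes _   = []
... | no y≢q  = y<q ∷ rest h walk
  where
  y<q : toℕ y < toℕ q
  y<q = ≤∧≢⇒< y≤q (λ e → y≢q (toℕ-injective e))
  rest : ∀ h → RespectsPath (y ∷ h) → All (λ x → toℕ x < toℕ q) (sinceLast q h)
  rest []      _            = []
  rest (z ∷ h) (y→z , walk) = stays-below h walk (≤-trans (step-≤ y→z) y<q)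

stays-above : ∀ {N} {q y : Fin N} h → RespectsPath (y ∷ h) → toℕ q ≤ toℕ y →
              All (λ x → toℕ q < toℕ x) (sinceLast q (y ∷ h))
stays-above {q = q} {y} h walk q≤y with y ≟ q
... | yes _   = []
... | no y≢q  = q<y ∷ rest h walk
  where
  q<y : toℕ q < toℕ y
  q<y = ≤∧≢⇒< q≤y (λ e → y≢q (toℕ-injective (sym e)))
  rest : ∀ h → RespectsPath (y ∷ h) → All (λ x → toℕ q < toℕ x) (sinceLast q h)
  rest []      _             = []
  rest (z ∷ h) (y→z , walk) = stays-above h walk (≤-pred (≤-trans q<y (step-≤ (step-sym y→z))))

newPages : ∀ {N} → List (Fin N) → List (Fin N) → List (Fin N)
newPages h []      = []
newPages h (q ∷ J) with q ∈? h
... | yes _ = newPages (q ∷ h) J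
... | no _  = q ∷ newPages (q ∷ h) J

newPages-⊆ : ∀ {N} {x : Fin N} h J → x ∈ newPages h J → x ∈ J
newPages-⊆ h (q ∷ J) x∈ with q ∈? h
newPages-⊆ h (q ∷ J) x∈          | yes _ = there (newPages-⊆ (q ∷ h) J x∈)
newPages-⊆ h (q ∷ J) (here refl) | no _  = here refl
newPages-⊆ h (q ∷ J) (there x∈)  | no _  = there (newPages-⊆ (q ∷ h) J x∈)

newPages-∉ : ∀ {N} {x : Fin N} h J → x ∈ newPages h J → x ∉ h
newPages-∉ h (q ∷ J) x∈ with q ∈? h
newPages-∉ h (q ∷ J) x∈          | yes _ = λ x∈h → newPages-∉ (q ∷ h) J x∈ (there x∈h)
newPages-∉ h (q ∷ J) (here refl) | no q∉h = q∉h
newPages-∉ h (q ∷ J) (there x∈)  | no _  = λ x∈h → newPages-∉ (q ∷ h) J x∈ (there x∈h)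

newPages-unique : ∀ {N} (h J : List (Fin N)) → Unique (newPages h J)
newPages-unique h []      = []
newPages-unique h (q ∷ J) with q ∈? h
... | yes _ = newPages-unique (q ∷ h) J
... | no _  = All.tabulate (λ x∈ q≡x → newPages-∉ (q ∷ h) J x∈ (here (sym q≡x)))
              ∷ newPages-unique (q ∷ h) J

newPages-step : ∀ {N} (h : List (Fin N)) q J →
                length (newPages (q ∷ h) J) ≤ length (newPages h (q ∷ J))
newPages-step h q J with q ∈? h
... | yes _ = ≤-refl
... | no _  = n≤1+n _

newPages-first : ∀ {N} {h : List (Fin N)} {q} J → q ∉ h →
                 length (newPages h (q ∷ J)) ≡ suc (length (newPages (q ∷ h) J))
newPages-first {h = h} {q} J q∉h with q ∈? h
... | yes q∈h = contradiction q∈h q∉h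
... | no _    = refl

module LRUOnPath (k' : ℕ) {N : ℕ} where
  open LRUCache k' {N}

  OnPath : Fin N → Set
  OnPath x = toℕ x ≤ k

  IsEnd : Fin N → Set
  IsEnd x = toℕ x ≡ 0 ⊎ toℕ x ≡ k

  isEnd? : (x : Fin N) → Dec (IsEnd x)
  isEnd? x = (toℕ x ℕ.≟ 0) ⊎-dec (toℕ x ℕ.≟ k)

  endRequests : List (Fin N) → ℕ
  endRequests J = length (filter isEnd? J)

  -- Since the last request to q the walk stayed on one side of q,
  -- which has fewer than k vertices; so fewer than k distinct pages are more recent than q
  -- and LRU still holds q.
  interior-cached : ∀ {q} h → RespectsPath (q ∷ h) → All OnPath h → q ∈ h →
                    0 < toℕ q → toℕ q < k → q ∈ lruCache h
  interior-cached {q} h walk onPath q∈h 0<q q<k with q ∈? lruCache h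
  ... | yes q∈ = q∈
  ... | no q∉  = contradiction (sinceLast-length k (recency h) (∈-recency⁺ q∈h) q∉)
                               (<⇒≱ (few-since h q∈h walk onPath q∉))
    where
    in-range : ∀ h lo hi → hi ∸ lo < k → All (λ x → lo ≤ toℕ x × toℕ x < hi) (sinceLast q h) →
               length (sinceLast q (recency h)) < k
    in-range h lo hi width inRange = ≤-<-trans
      (unique-range lo hi (sinceLast-unique (recency-unique h))
         (All.tabulate (λ x∈ → All.lookup inRange (sinceLast-recency h x∈))))
      width
    few-since : ∀ h → q ∈ h → RespectsPath (q ∷ h) → All OnPath h → q ∉ lruCache h →
                length (sinceLast q (recency h)) < k
    few-since (y ∷ h) _ (inj₁ refl , _) _ q∉ = contradiction (here refl) q∉
    few-since (y ∷ h) _ (inj₂ (inj₁ q+1≡y) , walk) onPath _ =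
      in-range (y ∷ h) (suc (toℕ q)) (suc k) (∸-monoʳ-< 0<q (<⇒≤ q<k))
        (All.tabulate (λ {x} x∈ →
           All.lookup (stays-above h walk (≤-trans (n≤1+n _) (≤-reflexive q+1≡y))) x∈ ,
           s≤s (All.lookup onPath (sinceLast-⊆ (y ∷ h) x∈))))
    few-since (y ∷ h) _ (inj₂ (inj₂ y+1≡q) , walk) _ _ =
      in-range (y ∷ h) 0 (toℕ q) q<k
        (All.tabulate (λ x∈ →
           z≤n , All.lookup (stays-below h walk (≤-trans (n≤1+n _) (≤-reflexive y+1≡q))) x∈))

  fault-charged : ∀ {q} h → RespectsPath (q ∷ h) → All OnPath h → OnPath q →
                  q ∉ lruCache h → q ∉ h ⊎ IsEnd q
  fault-charged {q} h walk onPath q≤k q∉ with q ∈? h | isEnd? q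
  ... | no q∉h  | _         = inj₁ q∉h
  ... | yes _   | yes end   = inj₂ end
  ... | yes q∈h | no ¬end   = contradiction
    (interior-cached h walk onPath q∈h (n≢0⇒n>0 (¬end ∘ inj₁)) (≤∧≢⇒< q≤k (¬end ∘ inj₂))) q∉

  endRequests-end : ∀ {q} J → IsEnd q → endRequests (q ∷ J) ≡ suc (endRequests J)
  endRequests-end J end = cong length (filter-accept isEnd? end)

  endRequests-step : ∀ q J → endRequests J ≤ endRequests (q ∷ J)
  endRequests-step q J with isEnd? q
  ... | yes end  = ≤-trans (n≤1+n _) (≤-reflexive (sym (endRequests-end J end)))
  ... | no ¬end  = ≤-reflexive (cong length (sym (filter-reject isEnd? ¬end)))

  -- Charging one request: a hit costs nothing, a fault is paid by a new page or an end
  -- request.  So if the bound below holds after serving q, it holds before.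
  charge-request : ∀ h q J → RespectsPath (q ∷ h) → All OnPath h → OnPath q →
    lruFrom (q ∷ h) J ≤ length (newPages (q ∷ h) J) + endRequests J →
    lruFrom h (q ∷ J) ≤ length (newPages h (q ∷ J)) + endRequests (q ∷ J)
  charge-request h q J walk onH onQ after with lru-serve h q J
  ... | inj₁ (_ , served) = begin
    lruFrom h (q ∷ J)                                 ≡⟨ served ⟩
    lruFrom (q ∷ h) J                                 ≤⟨ after ⟩
    length (newPages (q ∷ h) J) + endRequests J       ≤⟨ +-mono-≤ (newPages-step h q J) (endRequests-step q J) ⟩
    length (newPages h (q ∷ J)) + endRequests (q ∷ J) ∎
    where open ≤-Reasoning
  ... | inj₂ (q∉ , served) with fault-charged h walk onH onQ q∉
  ...   | inj₁ q∉h = begin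
    lruFrom h (q ∷ J)                                 ≡⟨ served ⟩
    suc (lruFrom (q ∷ h) J)                           ≤⟨ s≤s after ⟩
    suc (length (newPages (q ∷ h) J)) + endRequests J ≡⟨ cong (_+ endRequests J) (newPages-first J q∉h) ⟨
    length (newPages h (q ∷ J)) + endRequests J       ≤⟨ +-monoʳ-≤ _ (endRequests-step q J) ⟩
    length (newPages h (q ∷ J)) + endRequests (q ∷ J) ∎
    where open ≤-Reasoning
  ...   | inj₂ end = begin
    lruFrom h (q ∷ J)                                 ≡⟨ served ⟩
    suc (lruFrom (q ∷ h) J)                           ≤⟨ s≤s after ⟩
    suc (length (newPages (q ∷ h) J) + endRequests J) ≡⟨ +-suc _ _ ⟨
    length (newPages (q ∷ h) J) + suc (endRequests J) ≡⟨ cong (_ ℕ.+_) (endRequests-end J end) ⟨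
    length (newPages (q ∷ h) J) + endRequests (q ∷ J) ≤⟨ +-monoˡ-≤ _ (newPages-step h q J) ⟩
    length (newPages h (q ∷ J)) + endRequests (q ∷ J) ∎
    where open ≤-Reasoning

  -- Counting: from history h, LRU faults on J at most once per new page plus once per
  -- request to an end vertex.  (J ʳ++ h is the whole walk, read backwards.)
  lru-bound : ∀ h J → RespectsPath (J ʳ++ h) → All OnPath h → All OnPath J →
              lruFrom h J ≤ length (newPages h J) + endRequests J
  lru-bound h []      _    _   _           = z≤n
  lru-bound h (q ∷ J) walk onH (onQ ∷ onJ) =
    charge-request h q J (respects-ʳ++ J walk) onH onQ (lru-bound (q ∷ h) J walk (onQ ∷ onH) onJ)

  lru-upper : ∀ J → RespectsPath J → All OnPath J → LRU k J ≤ suc k + endRequests J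
  lru-upper J walk onJ = ≤-trans (lru-bound [] J (respects-reverse J walk) [] onJ)
    (+-monoˡ-≤ (endRequests J)
      (unique-range 0 (suc k) (newPages-unique [] J)
        (All.tabulate (λ x∈ → z≤n , s≤s (All.lookup onJ (newPages-⊆ [] J x∈))))))

  endRequests-++ : ∀ xs ys → endRequests (xs ++ ys) ≡ endRequests xs + endRequests ys
  endRequests-++ xs ys = trans (cong length (filter-++ isEnd? xs ys)) (length-++ (filter isEnd? xs))

  endRequests-interior : ∀ {xs} → All (¬_ ∘ IsEnd) xs → endRequests xs ≡ 0
  endRequests-interior interior = cong length (filter-none isEnd? interior)

  endRequests-↭ : ∀ {xs ys} → xs ↭ ys → endRequests xs ≡ endRequests ys
  endRequests-↭ xs↭ys = ↭-length (filter-↭ isEnd? xs↭ys)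

module LRULower (k' : ℕ) {N : ℕ} where
  open LRUCache k' {N}

  lruCache-length : ∀ h → length (lruCache h) ≤ k
  lruCache-length h = ≤-trans (≤-reflexive (length-take k (recency h))) (m⊓n≤m k _)

  lru-mono : ∀ h xs J → lruFrom (xs ʳ++ h) J ≤ lruFrom h (xs ++ J)
  lru-mono h []       J = ≤-refl
  lru-mono h (q ∷ xs) J with lru-serve h q (xs ++ J)
  ... | inj₁ (_ , served) = ≤-trans (lru-mono (q ∷ h) xs J) (≤-reflexive (sym served))
  ... | inj₂ (_ , served) = ≤-trans (m≤n⇒m≤1+n (lru-mono (q ∷ h) xs J)) (≤-reflexive (sym served))

  -- A block requesting some page that is not cached at its start causes at least one fault:
  -- hits never bring pages into the cache.
  lru-block : ∀ h xs J → Any (_∉ lruCache h) xs → suc (lruFrom (xs ʳ++ h) J) ≤ lruFrom h (xs ++ J)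
  lru-block h (q ∷ xs) J missing with lru-serve h q (xs ++ J) | missing
  ... | inj₁ (q∈ , _)     | here q∉ = contradiction q∈ q∉
  ... | inj₁ (q∈ , served) | there missing′ =
    ≤-trans (lru-block (q ∷ h) xs J (Any.map (λ x∉ x∈ → x∉ (lruCache-hit-⊆ q∈ x∈)) missing′))
            (≤-reflexive (sym served))
  ... | inj₂ (_ , served) | _ = ≤-trans (s≤s (lru-mono (q ∷ h) xs J)) (≤-reflexive (sym served))

  lru-repeated : ∀ {B U : List (Fin N)} → Unique U → k < length U → U ⊆ B →
                 ∀ n h → n ≤ lruFrom h (concat (replicate n B))
  lru-repeated             _    _   _   zero    h = z≤n
  lru-repeated {B} {U} uniq k<U U⊆B (suc n) h =
    ≤-trans (s≤s (lru-repeated uniq k<U U⊆B n (B ʳ++ h))) (lru-block h B _ missing)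
    where
    missing : Any (_∉ lruCache h) B
    missing with find (longer⇒∉ _≟_ (lruCache h) uniq (≤-<-trans (lruCache-length h) k<U))
    ... | x , x∈U , x∉ = lose (U⊆B x∈U) x∉

-- Its cache is determined by the list F of pages
-- on which it faulted so far (latest first): it is take k F, since a fault on q turns
-- the cache take k F into take k (q ∷ take k F) = take k (q ∷ F).
module FIFOCache (k' : ℕ) {N : ℕ} where

  k : ℕ
  k = suc k'

  fifoFrom : List (Fin N) → List (Fin N) → ℕ
  fifoFrom F J = runFaults (fifoStep k) (take k F) J

  fifo-hit : ∀ {F q} J → q ∈ take k F → fifoFrom F (q ∷ J) ≡ fifoFrom F J
  fifo-hit J q∈ = runFaults-hit J (fifoStep-hit k q∈)

  fifo-fault : ∀ {F q} J → q ∉ take k F → fifoFrom F (q ∷ J) ≡ suc (fifoFrom (q ∷ F) J)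
  fifo-fault {F} {q} J q∉ = trans (runFaults-fault J (fifoStep-fault k q∉))
    (cong (λ c → suc (runFaults (fifoStep k) (q ∷ c) J)) (take-take-suc k' F))

  fifo-hits : ∀ {F} xs J → All (_∈ take k F) xs → fifoFrom F (xs ++ J) ≡ fifoFrom F J
  fifo-hits []       J []          = refl
  fifo-hits (q ∷ xs) J (q∈ ∷ xs∈) = trans (fifo-hit (xs ++ J) q∈) (fifo-hits xs J xs∈)

  AllFault : List (Fin N) → List (Fin N) → Set
  AllFault F []       = ⊤
  AllFault F (q ∷ xs) = q ∉ take k F × AllFault (q ∷ F) xs

  fifo-sweep : ∀ {F} xs J → AllFault F xs → fifoFrom F (xs ++ J) ≡ length xs + fifoFrom (xs ʳ++ F) J
  fifo-sweep []       J _            = refl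
  fifo-sweep (q ∷ xs) J (q∉ , rest) = trans (fifo-fault (xs ++ J) q∉) (cong suc (fifo-sweep xs J rest))

  fresh-faults : ∀ {F} xs → Unique xs → All (_∉ F) xs → AllFault F xs
  fresh-faults []       _              _             = tt
  fresh-faults {F} (q ∷ xs) (q∉xs ∷ uniq) (q∉F ∷ xs∉F) =
    (λ q∈ → q∉F (∈-take⁻ k q∈)) ,
    fresh-faults xs uniq (All.zipWith (λ (q≢x , x∉F) → not-in q≢x x∉F) (q∉xs , xs∉F))
    where
    not-in : ∀ {x} → q ≢ x → x ∉ F → x ∉ q ∷ F
    not-in q≢x _   (here x≡q)  = q≢x (sym x≡q)
    not-in _   x∉F (there x∈F) = x∉F x∈F

  -- Midway, having requested the prefix ys of
  -- C = ys ++ q ∷ zs, the cache holds the k pages of ys and zs, so q faults.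
  cycle-faults : ∀ {C} F ys zs → Unique C → length C ≡ suc k → C ≡ ys ++ zs →
                 AllFault (ys ʳ++ (C ʳ++ F)) zs
  cycle-faults F ys []        _    _   _    = tt
  cycle-faults F ys (q ∷ zs) uniq len refl = q∉cache ,
    subst (λ G → AllFault G zs) (++-ʳ++ ys {q ∷ []})
      (cycle-faults F (ys ++ q ∷ []) zs uniq len (sym (++-assoc ys (q ∷ []) zs)))
    where
    open ≡-Reasoning
    widths : length ys + (length zs + 0) ≡ k
    widths = suc-injective (begin
      suc (length ys + (length zs + 0)) ≡⟨ cong (λ n → suc (length ys + n)) (+-identityʳ (length zs)) ⟩
      suc (length ys + length zs)       ≡⟨ +-suc (length ys) (length zs) ⟨
      length ys + length (q ∷ zs)       ≡⟨ length-++ ys ⟨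
      length (ys ++ q ∷ zs)             ≡⟨ len ⟩
      suc k                             ∎)
    cache : take k (ys ʳ++ ((ys ++ q ∷ zs) ʳ++ F)) ≡ ys ʳ++ (zs ʳ++ [])
    cache = begin
      take k (ys ʳ++ ((ys ++ q ∷ zs) ʳ++ F))                       ≡⟨ cong (λ G → take k (ys ʳ++ G)) (++-ʳ++ ys) ⟩
      take k (ys ʳ++ (zs ʳ++ (q ∷ ys ʳ++ F)))                      ≡⟨ cong (λ n → take n (ys ʳ++ (zs ʳ++ (q ∷ ys ʳ++ F)))) widths ⟨
      take (length ys + (length zs + 0)) (ys ʳ++ (zs ʳ++ (q ∷ ys ʳ++ F))) ≡⟨ take-ʳ++ ys _ _ ⟩
      ys ʳ++ take (length zs + 0) (zs ʳ++ (q ∷ ys ʳ++ F))          ≡⟨ cong (ys ʳ++_) (take-ʳ++ zs 0 _) ⟩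
      ys ʳ++ (zs ʳ++ [])                                           ∎
    q∉cache : q ∉ take k (ys ʳ++ ((ys ++ q ∷ zs) ʳ++ F))
    q∉cache q∈ with ∈-ʳ++⁻ ys (subst (q ∈_) cache q∈)
    ... | inj₁ q∈ys = unique-middle ys uniq (∈-++⁺ˡ q∈ys)
    ... | inj₂ q∈zs′ with ∈-ʳ++⁻ zs q∈zs′
    ...   | inj₁ q∈zs = unique-middle ys uniq (∈-++⁺ʳ ys q∈zs)

  fifo-cycle : ∀ {C} F J → Unique C → length C ≡ suc k →
               fifoFrom (C ʳ++ F) (C ++ J) ≡ suc k + fifoFrom (C ʳ++ (C ʳ++ F)) J
  fifo-cycle {C} F J uniq len =
    trans (fifo-sweep C J (cycle-faults F [] C uniq len refl)) (cong (_+ fifoFrom (C ʳ++ (C ʳ++ F)) J) len)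

  fifo-fresh : ∀ xs J → Unique xs → fifoFrom [] (xs ++ J) ≡ length xs + fifoFrom (xs ʳ++ []) J
  fifo-fresh xs J uniq = fifo-sweep xs J (fresh-faults xs uniq (All.tabulate (λ _ ())))

module Zigzag (k' : ℕ) {N : ℕ} (k<N : suc k' < N) where
  open LRUCache k' {N} using (k)
  open LRUOnPath k' {N}
  open LRULower k' {N}
  open FIFOCache k' {N} using (fifoFrom; fifo-fresh; fifo-cycle; fifo-hits)

  -- vertex i of P_N for i ≤ k (clamped to k beyond)
  page : ℕ → Fin N
  page i = fromℕ< (≤-<-trans (m⊓n≤n i k) k<N)

  toℕ-page : ∀ {i} → i ≤ k → toℕ (page i) ≡ i
  toℕ-page {i} i≤k = trans (toℕ-fromℕ< _) (m≤n⇒m⊓n≡m i≤k)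

  page-onPath : ∀ i → OnPath (page i)
  page-onPath i = subst (_≤ k) (sym (toℕ-fromℕ< _)) (m⊓n≤n i k)

  page-step : ∀ {i} → i < k → Step (page i) (page (suc i))
  page-step {i} i<k = inj₂ (inj₁ (trans (cong suc (toℕ-page (<⇒≤ i<k))) (sym (toℕ-page i<k))))

  climb : List (Fin N)
  climb = applyUpTo (page ∘ suc) k

  sweepUp : List (Fin N)
  sweepUp = page 0 ∷ climb

  descent : List (Fin N)
  descent = applyDownFrom (page ∘ suc) k'

  zigzag : List (Fin N)
  zigzag = descent ++ sweepUp

  I : ℕ → List (Fin N)
  I n = sweepUp ++ concat (replicate n zigzag)

  climb-walk : Walk (page 0) (page k) climb
  climb-walk = ascending page k page-step

  zigzag-walk : Walk (page k) (page k) zigzag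
  zigzag-walk = walk-++ (descending (page ∘ suc) k' (λ i<k' → step-sym (page-step (s≤s i<k'))))
                        (move (step-sym (page-step (s≤s z≤n))) climb-walk)

  rounds-walk : ∀ n → Walk (page k) (page k) (concat (replicate n zigzag))
  rounds-walk zero    = stay
  rounds-walk (suc n) = walk-++ zigzag-walk (rounds-walk n)

  I-respects : ∀ n → RespectsPath (I n)
  I-respects n = walk-respects (walk-++ climb-walk (rounds-walk n))

  I-onPath : ∀ n → All OnPath (I n)
  I-onPath n = All.++⁺ sweepUp-onPath (All.concat⁺ (All.replicate⁺ n (All.++⁺ descent-onPath sweepUp-onPath)))
    where
    sweepUp-onPath : All OnPath sweepUp
    sweepUp-onPath = All.applyUpTo⁺₂ page (suc k) page-onPath
    descent-onPath : All OnPath descent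
    descent-onPath = All.applyDownFrom⁺₂ (page ∘ suc) k' (page-onPath ∘ suc)

  sweepUp-unique : Unique sweepUp
  sweepUp-unique = Unique.applyUpTo⁺₁ page (suc k) distinct
    where
    distinct : ∀ {i j} → i < j → j < suc k → page i ≢ page j
    distinct {i} {j} i<j (s≤s j≤k) e =
      <-irrefl (trans (sym (toℕ-page (≤-trans (<⇒≤ i<j) j≤k))) (trans (cong toℕ e) (toℕ-page j≤k))) i<j

  sweepUp-length : length sweepUp ≡ suc k
  sweepUp-length = cong suc (length-applyUpTo (page ∘ suc) k)

  interior-page : ∀ {i} → i < k' → ¬ IsEnd (page (suc i))
  interior-page {i} i<k' (inj₁ e) with () ← trans (sym (toℕ-page (s≤s (<⇒≤ i<k')))) e
  interior-page {i} i<k' (inj₂ e) =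
    <-irrefl (trans (sym (toℕ-page (s≤s (<⇒≤ i<k')))) e) (s≤s i<k')

  sweepUp-ends : endRequests sweepUp ≡ 2
  sweepUp-ends = begin
    endRequests (page 0 ∷ climb)                  ≡⟨ cong length (filter-accept isEnd? (inj₁ (toℕ-page z≤n))) ⟩
    suc (endRequests climb)                       ≡⟨ cong (suc ∘ endRequests) (applyUpTo-∷ʳ (page ∘ suc) k') ⟨
    suc (endRequests (inner ++ [ page k ]))       ≡⟨ cong suc (endRequests-++ inner [ page k ]) ⟩
    suc (endRequests inner + endRequests [ page k ]) ≡⟨ cong₂ (λ a b → suc (a + b)) inner-ends last-end ⟩
    2                                             ∎
    where
    open ≡-Reasoning
    inner : List (Fin N)
    inner = applyUpTo (page ∘ suc) k'
    inner-ends : endRequests inner ≡ 0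
    inner-ends = endRequests-interior (All.applyUpTo⁺₁ (page ∘ suc) k' interior-page)
    last-end : endRequests [ page k ] ≡ 1
    last-end = cong length (filter-accept isEnd? (inj₂ (toℕ-page ≤-refl)))

  rounds-ends : ∀ n → endRequests (concat (replicate n zigzag)) ≡ n * 2
  rounds-ends zero    = refl
  rounds-ends (suc n) = begin
    endRequests (zigzag ++ rest)                                  ≡⟨ endRequests-++ zigzag rest ⟩
    endRequests (descent ++ sweepUp) + endRequests rest           ≡⟨ cong (_+ endRequests rest) (endRequests-++ descent sweepUp) ⟩
    (endRequests descent + endRequests sweepUp) + endRequests rest ≡⟨ cong₂ (λ a b → (a + b) + endRequests rest) descent-ends sweepUp-ends ⟩
    2 + endRequests rest                                          ≡⟨ cong (2 ℕ.+_) (rounds-ends n) ⟩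
    suc n * 2                                                     ∎
    where
    open ≡-Reasoning
    rest : List (Fin N)
    rest = concat (replicate n zigzag)
    descent-ends : endRequests descent ≡ 0
    descent-ends = endRequests-interior (All.applyDownFrom⁺₁ (page ∘ suc) k' interior-page)

  I-ends : ∀ n → endRequests (I n) ≡ suc n * 2
  I-ends n = trans (endRequests-++ sweepUp _) (cong₂ _+_ sweepUp-ends (rounds-ends n))

  -- After an up sweep FIFO holds k, …, 1, so the following descent consists of hits.
  descent-cached : ∀ F → All (_∈ take k (sweepUp ʳ++ F)) descent
  descent-cached F = All.applyDownFrom⁺₁ (page ∘ suc) k' (λ i<k' →
    subst (page (suc _) ∈_) (sym cache) (Any.reverse⁺ (∈-applyUpTo⁺ (page ∘ suc) (m≤n⇒m≤1+n i<k'))))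
    where
    cache : take k (climb ʳ++ (page 0 ∷ F)) ≡ climb ʳ++ []
    cache = trans (cong (λ n → take n (climb ʳ++ (page 0 ∷ F)))
                        (sym (trans (+-identityʳ _) (length-applyUpTo (page ∘ suc) k))))
                  (take-ʳ++ climb 0 (page 0 ∷ F))

  fifo-rounds : ∀ n F → fifoFrom (sweepUp ʳ++ F) (concat (replicate n zigzag)) ≡ n * suc k
  fifo-rounds zero    F = refl
  fifo-rounds (suc n) F = begin
    fifoFrom G ((descent ++ sweepUp) ++ rest)     ≡⟨ cong (fifoFrom G) (++-assoc descent sweepUp rest) ⟩
    fifoFrom G (descent ++ (sweepUp ++ rest))     ≡⟨ fifo-hits descent (sweepUp ++ rest) (descent-cached F) ⟩
    fifoFrom G (sweepUp ++ rest)                  ≡⟨ fifo-cycle F rest sweepUp-unique sweepUp-length ⟩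
    suc k + fifoFrom (sweepUp ʳ++ G) rest         ≡⟨ cong (suc k ℕ.+_) (fifo-rounds n G) ⟩
    suc n * suc k                                 ∎
    where
    open ≡-Reasoning
    G : List (Fin N)
    G = sweepUp ʳ++ F
    rest : List (Fin N)
    rest = concat (replicate n zigzag)

  FIFO-I : ∀ n → FIFO k (I n) ≡ suc n * suc k
  FIFO-I n = trans (fifo-fresh sweepUp _ sweepUp-unique)
                   (cong₂ _+_ sweepUp-length (fifo-rounds n []))

  -- Each round contains the k + 1 distinct pages of an up sweep, so LRU faults in it.
  LRU-I : ∀ n → n ≤ LRU k (I n)
  LRU-I n = ≤-trans
    (lru-repeated sweepUp-unique (≤-reflexive (sym sweepUp-length)) (∈-++⁺ʳ descent) n (sweepUp ʳ++ []))
    (lru-mono [] sweepUp (concat (replicate n zigzag)))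

ratio-bound : ∀ a l m f → l ≤ a + m * 2 → m * a ≤ f → a * l ≤ 2 * f + 2 * (a * a)
ratio-bound a l m f l≤ f≥ = begin
  a * l                  ≤⟨ *-monoʳ-≤ a l≤ ⟩
  a * (a + m * 2)        ≡⟨ expand ⟩
  a * a + 2 * (m * a)    ≤⟨ +-monoʳ-≤ (a * a) (*-monoʳ-≤ 2 f≥) ⟩
  a * a + 2 * f          ≡⟨ +-comm (a * a) (2 * f) ⟩
  2 * f + a * a          ≤⟨ +-monoʳ-≤ (2 * f) (m≤m+n (a * a) (a * a + 0)) ⟩
  2 * f + 2 * (a * a)    ∎
  where
  open ≤-Reasoning
  expand : a * (a + m * 2) ≡ a * a + 2 * (m * a)
  expand = solve 2 (λ a m → a :* (a :+ m :* con 2) := a :* a :+ con 2 :* (m :* a)) refl a m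

ratio-bound-ℤ : ∀ a l c f → a * l ≤ 2 * f + 2 * c → (+ a) *ℤ (+ l) +ℤ (+ 2) *ℤ (- (+ c)) ≤ℤ (+ 2) *ℤ (+ f)
ratio-bound-ℤ a l c f ineq = begin
  (+ a) *ℤ (+ l) +ℤ (+ 2) *ℤ (- (+ c))     ≡⟨ cong₂ _+ℤ_ (sym (ℤ.pos-* a l)) twice-neg ⟩
  + (a * l) +ℤ - (+ (2 * c))               ≤⟨ ℤ.+-monoˡ-≤ (- (+ (2 * c))) (+≤+ ineq) ⟩
  + (2 * f + 2 * c) +ℤ - (+ (2 * c))       ≡⟨ cong (_+ℤ - (+ (2 * c))) (ℤ.pos-+ (2 * f) (2 * c)) ⟩
  + (2 * f) +ℤ + (2 * c) +ℤ - (+ (2 * c))  ≡⟨ ℤ.+-assoc (+ (2 * f)) (+ (2 * c)) (- (+ (2 * c))) ⟩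
  + (2 * f) +ℤ (+ (2 * c) +ℤ - (+ (2 * c))) ≡⟨ cong (+ (2 * f) +ℤ_) (ℤ.+-inverseʳ (+ (2 * c))) ⟩
  + (2 * f) +ℤ + 0                         ≡⟨ ℤ.+-identityʳ (+ (2 * f)) ⟩
  + (2 * f)                                ≡⟨ ℤ.pos-* 2 f ⟩
  (+ 2) *ℤ (+ f)                           ∎
  where
  open ℤ.≤-Reasoning
  twice-neg : (+ 2) *ℤ (- (+ c)) ≡ - (+ (2 * c))
  twice-neg = trans (sym (ℤ.neg-distribʳ-* (+ 2) (+ c))) (cong -_ (sym (ℤ.pos-* 2 c)))

theorem4 : (k N : ℕ) → 1 ≤ k → k + 1 ≤ N →
    Σ[ I ∈ (ℕ → List (Fin N)) ] Σ[ b ∈ ℤ ]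
      ((∀ (n : ℕ) → 1 ≤ n → RespectsPath {N} (I n)) ×
       (∀ (M : ℕ) → ∃[ n₀ ] (∀ (n : ℕ) → n₀ ≤ n → 1 ≤ n → M ≤ LRU k (I n))) ×
       (∀ (n : ℕ) → 1 ≤ n → ∀ (f l : ℕ) →
          IsWorstPath (FIFO k) (I n) f → IsWorstPath (LRU k) (I n) l →
          (+ (k + 1)) *ℤ (+ l) +ℤ (+ 2) *ℤ b ≤ℤ (+ 2) *ℤ (+ f)))
theorem4 zero      N () _
theorem4 k@(suc k') N _  k+1≤N =
  I , - (+ (a * a)) , (λ n _ → I-respects n) , unbounded , competitive
  where
  a : ℕ
  a = k + 1
  a≡suc-k : a ≡ suc k
  a≡suc-k = +-comm k 1
  open Zigzag k' (subst (_≤ N) a≡suc-k k+1≤N)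
  open LRUOnPath k' {N} using (endRequests-↭; lru-upper)

  unbounded : ∀ M → ∃[ n₀ ] (∀ n → n₀ ≤ n → 1 ≤ n → M ≤ LRU k (I n))
  unbounded M = M , λ n M≤n _ → ≤-trans M≤n (LRU-I n)

  competitive : ∀ n → 1 ≤ n → ∀ f l → IsWorstPath (FIFO k) (I n) f → IsWorstPath (LRU k) (I n) l →
                (+ a) *ℤ (+ l) +ℤ (+ 2) *ℤ (- (+ (a * a))) ≤ℤ (+ 2) *ℤ (+ f)
  competitive n _ f l (_ , fifo-worst) ((J , J↭I , J-walk , refl) , _) =
    ratio-bound-ℤ a l (a * a) f (ratio-bound a l (suc n) f lru-J fifo-I)
    where
    fifo-I : suc n * a ≤ f
    fifo-I = subst (λ x → suc n * x ≤ f) (sym a≡suc-k)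
               (subst (_≤ f) (FIFO-I n) (fifo-worst (I n) ↭-refl (I-respects n)))
    -- the worst LRU value is attained by a permutation J of I n respecting P_N
    lru-J : LRU k J ≤ a + suc n * 2
    lru-J = subst₂ (λ x y → LRU k J ≤ x + y) (sym a≡suc-k) (trans (endRequests-↭ J↭I) (I-ends n))
              (lru-upper J J-walk (All-resp-↭ (↭-sym J↭I) (I-onPath n)))
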